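{- Let $D=(E,\mathcal{F})$ be a set system, let $a,b\in E$ with $a\neq b$, and let $A\subseteq E$ with $|A\cap\{a,b\}|\in\{0,2\}$. Then $\omega(D* A)=\omega(\widetilde{D}_{ab}* A)$.
   Context: A set system $D=(E,\mathcal{F})$ is a finite set $E$ together with a nonempty collection $\mathcal{F}\subseteq 2^E$ of feasible sets. $\triangle$ denotes symmetric difference. For $A\subseteq E$, the twist $D*A$ is the set system $(E,\{A\triangle X: X\in\mathcal{F}\})$. The width $\omega(D)$ of a set system is the size of a largest feasible set minus the size of a smallest feasible set. For distinct $a,b\in E$, the handle sliding of $a$ over $b$ is the set system $\widetilde{D}_{ab}=(E,\widetilde{\mathcal{F}}_{ab})$ with $\widetilde{\mathcal{F}}_{ab}=\mathcal{F}\triangle\{F\cup\{a\}: F\cup\{b\}\in\mathcal{F},\ F\subseteq E\setminus\{a,b\}\}$. -}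

module Defs where

open import Data.Bool using (Bool; true; false; _∧_; _xor_; not; if_then_else_)
open import Data.Nat using (ℕ; zero; suc; _∸_; _⊔_; _⊓_)
open import Data.Fin using (Fin)
open import Data.Fin.Subset using (Subset; inside; outside; ∣_∣; _∪_; _-_; ⁅_⁆)
open import Data.Vec using (Vec; []; _∷_; zipWith; lookup)
open import Data.List using (List; []; _∷_; map; _++_; filter; foldr)
open import Data.Product using (Σ; ∃; _,_)
open import Relation.Binary.PropositionalEquality using (_≡_)

Family : ℕ → Set
Family n = Subset n → Bool

record SetSystem (n : ℕ) : Set where
  constructor mkSetSystem
  field
    feasible : Family n
    nonempty : ∃ λ X → feasible X ≡ true
open SetSystem public

_△_ : ∀ {n} → Subset n → Subset n → Subset n
X △ Y = zipWith _xor_ X Y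

-- twist: feasible sets of D * A are {A △ X : X ∈ F};  Y = A △ X  iff  X = A △ Y
twistF : ∀ {n} → Family n → Subset n → Family n
twistF F A Y = F (A △ Y)

-- handle sliding: F~ = F △ {F' ∪ {a} : F' ∪ {b} ∈ F, F' ⊆ E ∖ {a,b}}.
-- Y belongs to the second collection iff a ∈ Y, b ∉ Y and (Y - a) ∪ {b} ∈ F.
isIn : ∀ {n} → Fin n → Subset n → Bool
isIn i X with lookup X i
... | inside = true
... | outside = false

slideF : ∀ {n} → Family n → Fin n → Fin n → Family n
slideF F a b Y = F Y xor (isIn a Y ∧ not (isIn b Y) ∧ F ((Y - a) ∪ ⁅ b ⁆))

allSubsets : ∀ n → List (Subset n)
allSubsets zero = [] ∷ []
allSubsets (suc n) = map (inside ∷_) (allSubsets n) ++ map (outside ∷_) (allSubsets n)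

feasibleSizes : ∀ {n} → Family n → List ℕ
feasibleSizes {n} F = foldr (λ X r → if F X then ∣ X ∣ ∷ r else r) [] (allSubsets n)

maxList : List ℕ → ℕ
maxList = foldr _⊔_ 0

-- minimum of a list of naturals bounded by n (all sizes are ≤ n)
minListBelow : ℕ → List ℕ → ℕ
minListBelow n = foldr _⊓_ n

width : ∀ {n} → Family n → ℕ
width {n} F = maxList (feasibleSizes F) ∸ minListBelow n (feasibleSizes F)

-- Where the slid system differs from D after twisting by A, at a set Y say, the set
-- Z = A △ Y contains a but not b and (Z − a) ∪ {b} is feasible in D.  That set is Z with
-- the coordinates a and b exchanged, and since A treats a and b alike, exchanging a and b
-- in Y gives a set of the same size feasible in both twisted systems.  So both realise the
-- same sizes of feasible sets, and the width only depends on those.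
module Submission where

open import Defs
open import Data.Nat using (ℕ)
open import Data.Fin using (Fin)
open import Data.Fin.Subset using (Subset; _∈_; _∉_)
open import Data.Sum using (_⊎_)
open import Data.Product using (_×_)
open import Relation.Binary.PropositionalEquality using (_≡_; _≢_)

open import Algebra.Properties.CommutativeSemigroup using (x∙yz≈y∙xz)
open import Data.Bool using (Bool; true; false; _∨_; _xor_; if_then_else_)
open import Data.Bool.Properties using (∨-identityʳ; ∨-zeroʳ; ∧-zeroʳ; xor-identityʳ)
open import Data.Empty using (⊥-elim)
open import Data.Fin using (zero; suc)
open import Data.Fin.Properties using (_≟_)
open import Data.Fin.Subset using (inside; outside; ∣_∣; _∪_; _-_; ⁅_⁆)
open import Data.Fin.Subset.Properties using (x∈⁅x⁆; x≢y⇒x∉⁅y⁆; p─⊥≡p)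
open import Data.List using (List; foldr) renaming (_∷_ to _∷ₗ_; [] to []ₗ)
open import Data.List.Membership.Propositional using () renaming (_∈_ to _∈ₗ_)
open import Data.List.Membership.Propositional.Properties using (∈-map⁺; ∈-++⁺ˡ; ∈-++⁺ʳ)
open import Data.List.Properties using (foldr-preservesᵇ; foldr-preservesᵒ)
open import Data.List.Relation.Binary.Subset.Propositional using (_⊆_)
import Data.List.Relation.Unary.All as All
import Data.List.Relation.Unary.Any as Any
open import Data.Nat using (_+_; _≤_; _∸_; z≤n)
open import Data.Nat.Properties
  using (≤-refl; ≤-antisym; ⊔-lub; ⊓-glb; m≤n⇒m≤n⊔o; m≤n⇒m≤o⊔n; m≤n⇒m⊓o≤n; m≤n⇒o⊓m≤n;
         +-cancelˡ-≡; +-commutativeSemigroup)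
open import Data.Product using (∃; _,_; proj₁; proj₂)
open import Data.Sum using (inj₁; inj₂; [_,_])
open import Data.Vec using (Vec; []; _∷_; lookup; tabulate; _[_]≔_)
open import Data.Vec.Properties
  using (lookup∘update; lookup∘update′; lookup-zipWith; tabulate∘lookup; tabulate-cong;
         []=⇒lookup; lookup⇒[]=)
open import Function using (_∘_)
open import Relation.Binary.PropositionalEquality using (refl; sym; trans; cong; cong₂; subst; module ≡-Reasoning)
open import Relation.Nullary using (yes; no)

private
  variable
    n : ℕ

maxList-mono-⊆ : ∀ {xs ys} → xs ⊆ ys → maxList xs ≤ maxList ys
maxList-mono-⊆ {ys = ys} xs⊆ys =
  foldr-preservesᵇ ⊔-lub z≤n (All.tabulate (∈⇒≤maxList ∘ xs⊆ys))
  where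
  ∈⇒≤maxList : ∀ {x} → x ∈ₗ ys → x ≤ maxList ys
  ∈⇒≤maxList x∈ys = foldr-preservesᵒ (λ x y → [ m≤n⇒m≤n⊔o y , m≤n⇒m≤o⊔n x ]) 0 ys
    (inj₂ (Any.map (λ { refl → ≤-refl }) x∈ys))

minListBelow-anti-⊆ : ∀ k {xs ys} → xs ⊆ ys → minListBelow k ys ≤ minListBelow k xs
minListBelow-anti-⊆ k {ys = ys} xs⊆ys =
  foldr-preservesᵇ ⊓-glb (min≤ (inj₁ ≤-refl)) (All.tabulate (min≤ ∘ inj₂ ∘ Any.map (λ { refl → ≤-refl }) ∘ xs⊆ys))
  where
  min≤ : ∀ {v} → k ≤ v ⊎ Any.Any (_≤ v) ys → minListBelow k ys ≤ v
  min≤ = foldr-preservesᵒ (λ x y → [ m≤n⇒m⊓o≤n y , m≤n⇒o⊓m≤n x ]) k ys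

∈-allSubsets : ∀ (X : Subset n) → X ∈ₗ allSubsets n
∈-allSubsets []            = Any.here refl
∈-allSubsets (inside ∷ X)  = ∈-++⁺ˡ (∈-map⁺ (inside ∷_) (∈-allSubsets X))
∈-allSubsets (outside ∷ X) = ∈-++⁺ʳ _ (∈-map⁺ (outside ∷_) (∈-allSubsets X))

-- feasibleSizes G is sizesIn G (allSubsets n); the list is abstracted to allow induction.
sizesIn : Family n → List (Subset n) → List ℕ
sizesIn G = foldr (λ X r → if G X then ∣ X ∣ ∷ₗ r else r) []ₗ

∈-sizesIn⁺ : ∀ {G : Family n} {X L} → X ∈ₗ L → G X ≡ true → ∣ X ∣ ∈ₗ sizesIn G L
∈-sizesIn⁺ (Any.here refl) GX rewrite GX = Any.here refl
∈-sizesIn⁺ {G = G} {L = Y ∷ₗ L} (Any.there X∈L) GX with G Y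
... | true  = Any.there (∈-sizesIn⁺ X∈L GX)
... | false = ∈-sizesIn⁺ X∈L GX

∈-sizesIn⁻ : ∀ {G : Family n} {k} L → k ∈ₗ sizesIn G L → ∃ λ X → G X ≡ true × ∣ X ∣ ≡ k
∈-sizesIn⁻ {G = G} (Y ∷ₗ L) k∈ with G Y in GY | k∈
... | true  | Any.here k≡∣Y∣ = Y , GY , sym k≡∣Y∣
... | true  | Any.there k∈′ = ∈-sizesIn⁻ L k∈′
... | false | k∈′           = ∈-sizesIn⁻ L k∈′

_≲_ : Family n → Family n → Set
G ≲ H = ∀ {X} → G X ≡ true → ∃ λ Y → H Y ≡ true × ∣ Y ∣ ≡ ∣ X ∣

feasibleSizes-mono : ∀ {G H : Family n} → G ≲ H → feasibleSizes G ⊆ feasibleSizes H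
feasibleSizes-mono {n} G≲H k∈ with ∈-sizesIn⁻ (allSubsets n) k∈
... | X , GX , refl with G≲H GX
... | Y , HY , ∣Y∣≡∣X∣ = subst (_∈ₗ _) ∣Y∣≡∣X∣ (∈-sizesIn⁺ (∈-allSubsets Y) HY)

width-cong : ∀ {G H : Family n} → G ≲ H → H ≲ G → width G ≡ width H
width-cong {n} G≲H H≲G = cong₂ _∸_
  (≤-antisym (maxList-mono-⊆ (feasibleSizes-mono G≲H)) (maxList-mono-⊆ (feasibleSizes-mono H≲G)))
  (≤-antisym (minListBelow-anti-⊆ n (feasibleSizes-mono H≲G)) (minListBelow-anti-⊆ n (feasibleSizes-mono G≲H)))

≲-by-repair : ∀ {G H : Family n} (σ : Subset n → Subset n) → (∀ X → ∣ σ X ∣ ≡ ∣ X ∣) →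
              (∀ X → G X ≢ H X → H (σ X) ≡ true) → G ≲ H
≲-by-repair {G = G} {H} σ ∣σX∣≡∣X∣ repair {X} GX with H X in HX
... | true  = X , HX , refl
... | false = σ X , repair X (λ GX≡HX → true≢false (trans (sym GX) (trans GX≡HX HX))) , ∣σX∣≡∣X∣ X
  where
  true≢false : true ≢ false
  true≢false ()

width-cong-by-repair : ∀ {G H : Family n} (σ : Subset n → Subset n) → (∀ X → ∣ σ X ∣ ≡ ∣ X ∣) →
                       (∀ X → G X ≢ H X → G (σ X) ≡ true × H (σ X) ≡ true) → width G ≡ width H
width-cong-by-repair σ ∣σX∣≡∣X∣ repair = width-cong
  (≲-by-repair σ ∣σX∣≡∣X∣ (λ X → proj₂ ∘ repair X))
  (≲-by-repair σ ∣σX∣≡∣X∣ (λ X → proj₁ ∘ repair X ∘ (_∘ sym)))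

lookup-ext : ∀ {A : Set} {xs ys : Vec A n} → (∀ i → lookup xs i ≡ lookup ys i) → xs ≡ ys
lookup-ext {xs = xs} {ys} eq = begin
  xs                 ≡⟨ tabulate∘lookup xs ⟨
  tabulate (lookup xs) ≡⟨ tabulate-cong eq ⟩
  tabulate (lookup ys) ≡⟨ tabulate∘lookup ys ⟩
  ys                 ∎
  where open ≡-Reasoning

∉⇒lookup≡outside : ∀ {p : Subset n} {x} → x ∉ p → lookup p x ≡ outside
∉⇒lookup≡outside {p = p} {x} x∉p with lookup p x in px
... | inside  = ⊥-elim (x∉p (lookup⇒[]= x p px))
... | outside = refl

lookup-⁅x⁆-x : ∀ (x : Fin n) → lookup ⁅ x ⁆ x ≡ inside
lookup-⁅x⁆-x x = []=⇒lookup (x∈⁅x⁆ x)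

lookup-⁅y⁆-x : ∀ {x y : Fin n} → x ≢ y → lookup ⁅ y ⁆ x ≡ outside
lookup-⁅y⁆-x x≢y = ∉⇒lookup≡outside (x≢y⇒x∉⁅y⁆ x≢y)

lookup-[p-x]-x : ∀ (p : Subset n) x → lookup (p - x) x ≡ outside
lookup-[p-x]-x (_ ∷ p) zero    = refl
lookup-[p-x]-x (_ ∷ p) (suc x) = lookup-[p-x]-x p x

lookup-[p-x]-y : ∀ (p : Subset n) {x y} → y ≢ x → lookup (p - x) y ≡ lookup p y
lookup-[p-x]-y (_ ∷ p) {zero}  {zero}  y≢x = ⊥-elim (y≢x refl)
lookup-[p-x]-y (_ ∷ p) {suc x} {zero}  y≢x = refl
lookup-[p-x]-y (_ ∷ p) {zero}  {suc y} y≢x = cong (λ q → lookup q y) (p─⊥≡p p)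
lookup-[p-x]-y (_ ∷ p) {suc x} {suc y} y≢x = lookup-[p-x]-y p (y≢x ∘ cong suc)

isIn≡lookup : ∀ (i : Fin n) X → isIn i X ≡ lookup X i
isIn≡lookup i X with lookup X i
... | inside  = refl
... | outside = refl

weight : Bool → ℕ
weight x = ∣ x ∷ [] ∣

∣x∷p∣≡weight[x]+∣p∣ : ∀ x (p : Subset n) → ∣ x ∷ p ∣ ≡ weight x + ∣ p ∣
∣x∷p∣≡weight[x]+∣p∣ inside  p = refl
∣x∷p∣≡weight[x]+∣p∣ outside p = refl

∣[]≔∣ : ∀ (p : Subset n) i x → weight (lookup p i) + ∣ p [ i ]≔ x ∣ ≡ weight x + ∣ p ∣
∣[]≔∣ (y ∷ p) zero x = begin
  weight y + ∣ x ∷ p ∣              ≡⟨ cong (weight y +_) (∣x∷p∣≡weight[x]+∣p∣ x p) ⟩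
  weight y + (weight x + ∣ p ∣)   ≡⟨ x∙yz≈y∙xz +-commutativeSemigroup (weight y) (weight x) ∣ p ∣ ⟩
  weight x + (weight y + ∣ p ∣)   ≡⟨ cong (weight x +_) (∣x∷p∣≡weight[x]+∣p∣ y p) ⟨
  weight x + ∣ y ∷ p ∣              ∎
  where open ≡-Reasoning
∣[]≔∣ (y ∷ p) (suc i) x = begin
  weight (lookup p i) + ∣ y ∷ p [ i ]≔ x ∣            ≡⟨ cong (weight (lookup p i) +_) (∣x∷p∣≡weight[x]+∣p∣ y (p [ i ]≔ x)) ⟩
  weight (lookup p i) + (weight y + ∣ p [ i ]≔ x ∣) ≡⟨ x∙yz≈y∙xz +-commutativeSemigroup (weight (lookup p i)) (weight y) ∣ p [ i ]≔ x ∣ ⟩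
  weight y + (weight (lookup p i) + ∣ p [ i ]≔ x ∣) ≡⟨ cong (weight y +_) (∣[]≔∣ p i x) ⟩
  weight y + (weight x + ∣ p ∣)                   ≡⟨ x∙yz≈y∙xz +-commutativeSemigroup (weight y) (weight x) ∣ p ∣ ⟩
  weight x + (weight y + ∣ p ∣)                   ≡⟨ cong (weight x +_) (∣x∷p∣≡weight[x]+∣p∣ y p) ⟨
  weight x + ∣ y ∷ p ∣                              ∎
  where open ≡-Reasoning

slideF-b∈ : ∀ (F : Family n) a b {p} → lookup p b ≡ inside → slideF F a b p ≡ F p
slideF-b∈ F a b {p} pb rewrite isIn≡lookup b p | pb | ∧-zeroʳ (isIn a p) = xor-identityʳ (F p)

swap : Fin n → Fin n → Subset n → Subset n
swap a b p = (p [ a ]≔ lookup p b) [ b ]≔ lookup p a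

module _ {a b : Fin n} (a≢b : a ≢ b) where

  lookup-swap-a : ∀ p → lookup (swap a b p) a ≡ lookup p b
  lookup-swap-a p = trans (lookup∘update′ a≢b (p [ a ]≔ lookup p b) _) (lookup∘update a p _)

  lookup-swap-b : ∀ p → lookup (swap a b p) b ≡ lookup p a
  lookup-swap-b p = lookup∘update b (p [ a ]≔ lookup p b) _

  lookup-swap-other : ∀ p {i} → i ≢ a → i ≢ b → lookup (swap a b p) i ≡ lookup p i
  lookup-swap-other p i≢a i≢b =
    trans (lookup∘update′ i≢b (p [ a ]≔ lookup p b) _) (lookup∘update′ i≢a p _)

  ∣swap∣ : ∀ p → ∣ swap a b p ∣ ≡ ∣ p ∣
  ∣swap∣ p = +-cancelˡ-≡ (weight (lookup p b)) _ _ (begin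
    weight (lookup p b) + ∣ swap a b p ∣ ≡⟨ cong (λ x → weight x + ∣ swap a b p ∣) (lookup∘update′ (a≢b ∘ sym) p _) ⟨
    weight (lookup p′ b) + ∣ swap a b p ∣ ≡⟨ ∣[]≔∣ p′ b (lookup p a) ⟩
    weight (lookup p a) + ∣ p′ ∣         ≡⟨ ∣[]≔∣ p a (lookup p b) ⟩
    weight (lookup p b) + ∣ p ∣          ∎)
    where
    open ≡-Reasoning
    p′ = p [ a ]≔ lookup p b

  ≡swap : ∀ {p q : Subset n} → lookup p a ≡ lookup q b → lookup p b ≡ lookup q a →
          (∀ {i} → i ≢ a → i ≢ b → lookup p i ≡ lookup q i) → p ≡ swap a b q
  ≡swap {p} {q} pa≡qb pb≡qa pi≡qi = lookup-ext λ i → case i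
    where
    case : ∀ i → lookup p i ≡ lookup (swap a b q) i
    case i with i ≟ a | i ≟ b
    ... | yes refl | _        = trans pa≡qb (sym (lookup-swap-a q))
    ... | no  _    | yes refl = trans pb≡qa (sym (lookup-swap-b q))
    ... | no  i≢a  | no  i≢b  = trans (pi≡qi i≢a i≢b) (sym (lookup-swap-other q i≢a i≢b))

  [p-a]∪⁅b⁆≡swap : ∀ {p} → lookup p a ≡ inside → lookup p b ≡ outside → (p - a) ∪ ⁅ b ⁆ ≡ swap a b p
  [p-a]∪⁅b⁆≡swap {p} pa pb = ≡swap at-a at-b at-other
    where
    lookup-∪ : ∀ i → lookup ((p - a) ∪ ⁅ b ⁆) i ≡ (lookup (p - a) i ∨ lookup ⁅ b ⁆ i)
    lookup-∪ i = lookup-zipWith _∨_ i (p - a) ⁅ b ⁆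
    at-a : lookup ((p - a) ∪ ⁅ b ⁆) a ≡ lookup p b
    at-a = trans (lookup-∪ a) (trans (cong₂ _∨_ (lookup-[p-x]-x p a) (lookup-⁅y⁆-x a≢b)) (sym pb))
    at-b : lookup ((p - a) ∪ ⁅ b ⁆) b ≡ lookup p a
    at-b = trans (lookup-∪ b) (trans (cong (lookup (p - a) b ∨_) (lookup-⁅x⁆-x b)) (trans (∨-zeroʳ _) (sym pa)))
    at-other : ∀ {i} → i ≢ a → i ≢ b → lookup ((p - a) ∪ ⁅ b ⁆) i ≡ lookup p i
    at-other {i} i≢a i≢b = trans (lookup-∪ i)
      (trans (cong₂ _∨_ (lookup-[p-x]-y p i≢a) (lookup-⁅y⁆-x i≢b)) (∨-identityʳ _))

  △-swap : ∀ {A} → lookup A a ≡ lookup A b → ∀ p → A △ swap a b p ≡ swap a b (A △ p)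
  △-swap {A} Aa≡Ab p = ≡swap at-a at-b at-other
    where
    lookup-△ : ∀ q i → lookup (A △ q) i ≡ lookup A i xor lookup q i
    lookup-△ q i = lookup-zipWith _xor_ i A q
    at-a : lookup (A △ swap a b p) a ≡ lookup (A △ p) b
    at-a = trans (lookup-△ (swap a b p) a)
      (trans (cong₂ _xor_ Aa≡Ab (lookup-swap-a p)) (sym (lookup-△ p b)))
    at-b : lookup (A △ swap a b p) b ≡ lookup (A △ p) a
    at-b = trans (lookup-△ (swap a b p) b)
      (trans (cong₂ _xor_ (sym Aa≡Ab) (lookup-swap-b p)) (sym (lookup-△ p a)))
    at-other : ∀ {i} → i ≢ a → i ≢ b → lookup (A △ swap a b p) i ≡ lookup (A △ p) i
    at-other {i} i≢a i≢b = trans (lookup-△ (swap a b p) i)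
      (trans (cong (lookup A i xor_) (lookup-swap-other p i≢a i≢b)) (sym (lookup-△ p i)))

  slideF-disagreement : ∀ (F : Family n) p → F p ≢ slideF F a b p →
    lookup p a ≡ inside × lookup p b ≡ outside × F (swap a b p) ≡ true
  slideF-disagreement F p differ
    with isIn a p in pa | isIn b p in pb | F ((p - a) ∪ ⁅ b ⁆) in Fp′
  ... | true  | false | true  = pa′ , pb′ , trans (cong F (sym ([p-a]∪⁅b⁆≡swap pa′ pb′))) Fp′
    where
    pa′ = trans (sym (isIn≡lookup a p)) pa
    pb′ = trans (sym (isIn≡lookup b p)) pb
  ... | false | _     | _     = ⊥-elim (differ (sym (xor-identityʳ _)))
  ... | true  | true  | _     = ⊥-elim (differ (sym (xor-identityʳ _)))
  ... | true  | false | false = ⊥-elim (differ (sym (xor-identityʳ _)))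

  twist-slide-disagreement : ∀ {A} → lookup A a ≡ lookup A b → ∀ (F : Family n) Y →
    twistF F A Y ≢ twistF (slideF F a b) A Y →
    twistF F A (swap a b Y) ≡ true × twistF (slideF F a b) A (swap a b Y) ≡ true
  twist-slide-disagreement {A} Aa≡Ab F Y differ = F[A△swapY] , slideF[A△swapY]
    where
    Z = A △ Y
    disagreement = slideF-disagreement F Z differ
    F[swapZ] = proj₂ (proj₂ disagreement)
    F[A△swapY] : F (A △ swap a b Y) ≡ true
    F[A△swapY] = trans (cong F (△-swap Aa≡Ab Y)) F[swapZ]
    slideF[A△swapY] : slideF F a b (A △ swap a b Y) ≡ true
    slideF[A△swapY] = begin
      slideF F a b (A △ swap a b Y) ≡⟨ cong (slideF F a b) (△-swap Aa≡Ab Y) ⟩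
      slideF F a b (swap a b Z)     ≡⟨ slideF-b∈ F a b (trans (lookup-swap-b Z) (proj₁ disagreement)) ⟩
      F (swap a b Z)                ≡⟨ F[swapZ] ⟩
      true                          ∎
      where open ≡-Reasoning

∈-agree⇒lookup≡ : ∀ {A : Subset n} {a b} → (a ∉ A × b ∉ A) ⊎ (a ∈ A × b ∈ A) → lookup A a ≡ lookup A b
∈-agree⇒lookup≡ (inj₁ (a∉A , b∉A)) = trans (∉⇒lookup≡outside a∉A) (sym (∉⇒lookup≡outside b∉A))
∈-agree⇒lookup≡ (inj₂ (a∈A , b∈A)) = trans ([]=⇒lookup a∈A) (sym ([]=⇒lookup b∈A))

proposition3p2 : ∀ {n} (D : SetSystem n) (a b : Fin n) (A : Subset n) →
    a ≢ b →
    ((a ∉ A × b ∉ A) ⊎ (a ∈ A × b ∈ A)) →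
    width (twistF (feasible D) A) ≡ width (twistF (slideF (feasible D) a b) A)
proposition3p2 D a b A a≢b A∩ab =
  width-cong-by-repair (swap a b) (∣swap∣ a≢b) (twist-slide-disagreement a≢b (∈-agree⇒lookup≡ A∩ab) (feasible D))
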